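{- Let $t$ be a prime number. Then there are exactly two pairs $(x,y)$ of integers with $0<x\le t$ and $0<y\le t+1$ satisfying $\frac{x^2+x}{y}=t$. -}

module Defs where

open import Data.Nat using (ℕ; suc; _+_; _*_; _≤_; _<_)
open import Data.Product using (_×_)
open import Relation.Binary.PropositionalEquality using (_≡_)

-- Since y > 0, the rational equation (x² + x)/y = t is equivalent to
-- x² + x = t · y (clearing the nonzero denominator).
IsSolution : ℕ → ℕ → ℕ → Set
IsSolution t x y =
  (0 < x) × (x ≤ t) × (0 < y) × (y ≤ t + 1) × (x * x + x ≡ t * y)

{-# OPTIONS --safe #-}
module Submission where

open import Defs
open import Data.Nat using (ℕ; zero; suc; _+_; _*_; _≤_; _<_; z≤n; s≤s; NonZero)
open import Data.Nat.Properties
open import Data.Nat.Divisibility using (_∣_; divides)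
open import Data.Nat.Primality using (Prime; euclidsLemma)
open import Data.Product using (Σ; _×_; _,_; proj₁; proj₂)
open import Data.Sum using (_⊎_; inj₁; inj₂)
open import Data.Empty using (⊥-elim)
open import Relation.Binary.PropositionalEquality

-- A solution satisfies x (x + 1) = t y, so the prime t divides x or x + 1.
-- Both lie strictly between 0 and 2t, where the only multiple of t is t itself:
-- t ∣ x gives (t , t + 1), and t ∣ x + 1 gives (t - 1 , t - 1).

x*x+x≡x*[1+x] : ∀ x → x * x + x ≡ x * suc x
x*x+x≡x*[1+x] x = trans (+-comm (x * x) x) (sym (*-suc x x))

∣∧0<n<2*m⇒n≡m : ∀ {m n} → m ∣ n → 0 < n → n < 2 * m → n ≡ m
∣∧0<n<2*m⇒n≡m (divides zero refl) ()
∣∧0<n<2*m⇒n≡m {m} (divides 1 refl) _ _ = +-identityʳ m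
∣∧0<n<2*m⇒n≡m {m} (divides (suc (suc q)) refl) _ n<2m =
  ⊥-elim (<⇒≱ n<2m (*-monoˡ-≤ m {2} {suc (suc q)} (s≤s (s≤s z≤n))))

solution-cancel : ∀ t x {y y′} → .{{NonZero t}} →
  x * x + x ≡ t * y → x * x + x ≡ t * y′ → y ≡ y′
solution-cancel t x eq eq′ = *-cancelˡ-≡ _ _ t (trans (sym eq) eq′)

t∣x*[1+x] : ∀ t x y → x * x + x ≡ t * y → t ∣ x * suc x
t∣x*[1+x] t x y eq = divides y (trans (sym (x*x+x≡x*[1+x] x)) (trans eq (*-comm t y)))

module _ (k : ℕ) where

  private
    t = suc (suc k)

  n<2*t : ∀ {n} → n ≤ suc t → n < 2 * t
  n<2*t n≤1+t = ≤-<-trans n≤1+t (begin-strict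
    suc t           ≡⟨ +-comm 1 t ⟩
    t + 1           <⟨ +-monoʳ-< t (s≤s (s≤s z≤n)) ⟩
    t + t           ≡⟨ cong (t +_) (sym (+-identityʳ t)) ⟩
    2 * t           ∎)
    where open ≤-Reasoning

  upper-equation : t * t + t ≡ t * (t + 1)
  upper-equation = trans (x*x+x≡x*[1+x] t) (cong (t *_) (+-comm 1 t))

  lower-equation : suc k * suc k + suc k ≡ t * suc k
  lower-equation = trans (x*x+x≡x*[1+x] (suc k)) (*-comm (suc k) t)

  upper-solution : IsSolution t t (t + 1)
  upper-solution = s≤s z≤n , ≤-refl , s≤s z≤n , ≤-refl , upper-equation

  lower-solution : IsSolution t (suc k) (suc k)
  lower-solution =
    s≤s z≤n , n≤1+n (suc k) , s≤s z≤n , m≤n⇒m≤n+o 1 (n≤1+n (suc k)) , lower-equation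

  solutions-classification : Prime t → ∀ x y → IsSolution t x y →
    ((x , y) ≡ (t , t + 1)) ⊎ ((x , y) ≡ (suc k , suc k))
  solutions-classification t-prime x y (0<x , x≤t , _ , _ , eq)
    with euclidsLemma x (suc x) t-prime (t∣x*[1+x] t x y eq)
  ... | inj₁ t∣x with ∣∧0<n<2*m⇒n≡m t∣x 0<x (n<2*t (m≤n⇒m≤1+n x≤t))
  ...   | refl = inj₁ (cong (t ,_) (solution-cancel t t eq upper-equation))
  solutions-classification t-prime x y (0<x , x≤t , _ , _ , eq)
      | inj₂ t∣1+x with ∣∧0<n<2*m⇒n≡m t∣1+x (s≤s z≤n) (n<2*t (s≤s x≤t))
  ...   | refl = inj₂ (cong (suc k ,_) (solution-cancel t (suc k) eq lower-equation))

lemma6p4 : (t : ℕ) → Prime t →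
    Σ (ℕ × ℕ) λ p → Σ (ℕ × ℕ) λ q →
    (p ≢ q)
    × IsSolution t (proj₁ p) (proj₂ p)
    × IsSolution t (proj₁ q) (proj₂ q)
    × ((x y : ℕ) → IsSolution t x y → ((x , y) ≡ p) ⊎ ((x , y) ≡ q))
lemma6p4 (suc (suc k)) t-prime =
  (suc (suc k) , suc (suc k) + 1) , (suc k , suc k) ,
  (λ eq → 1+n≢n (cong proj₁ eq)) ,
  upper-solution k , lower-solution k ,
  solutions-classification k t-prime
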